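{- Let $s$ and $t$ be positive integers and let $H_1,\ldots,H_s$, $H'_1,\ldots,H'_t$ be loosely connected ordered graphs. If $(H_i,H'_j)$ is Ramsey finite for all $i\in[s]$, $j\in[t]$, then $(H_1\sqcup\cdots\sqcup H_s,\ H'_1\sqcup\cdots\sqcup H'_t)$ is Ramsey finite.
   Context: An ordered graph is a finite simple graph together with a linear order of its vertex set. A copy of an ordered graph $H$ in $F$ is a subgraph of $F$ (with inherited order) isomorphic to $H$ via an order-preserving bijection. For ordered graphs $H,H'$, $R_<(H,H')$ is the set of ordered graphs $F$ such that every red/blue coloring of the edges of $F$ contains a red copy of $H$ or a blue copy of $H'$; $F\in R_<(H,H')$ is minimal if no proper subgraph of $F$ lies in $R_<(H,H')$; $(H,H')$ is Ramsey finite if $R_<(H,H')$ has only finitely many minimal elements (up to order-preserving isomorphism). An interval of an ordered graph $G$ is a set of consecutive vertices. An ordered graph $G$ with at least two vertices is loosely connected if for every partition $V(G)=V_1\,\dot\cup\, V_2$ into two nonempty disjoint intervals there is an edge with one endpoint in $V_1$ and the other in $V_2$. The intervally disjoint union $G\sqcup G'$ of ordered graphs is the vertex-disjoint union of $G$ and $G'$ in which all vertices of $G$ precede all vertices of $G'$. -}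

module Defs where

open import Data.Nat using (ℕ; zero; suc; _+_) renaming (_≤_ to _≤ℕ_; _<_ to _<ℕ_)
open import Data.Fin using (Fin; zero; suc; toℕ; splitAt; _<_)
open import Data.Bool using (Bool; true; false)
open import Data.Sum using (_⊎_; inj₁; inj₂)
open import Data.Product using (Σ; _×_; _,_; ∃)
open import Data.List using (List)
open import Data.List.Membership.Propositional using (_∈_)
open import Relation.Binary.PropositionalEquality using (_≡_; _≢_)
open import Relation.Nullary using (¬_)

-- The edge {i,j} with i < j is present iff adj i j ≡ true; values of adj
-- at pairs (i,j) with i ≥ j are ignored (see Edge).
record OrdGraph : Set where
  constructor mkOG
  field
    size : ℕ
    adj  : Fin size → Fin size → Bool
open OrdGraph public

Edge : (G : OrdGraph) → Fin (size G) → Fin (size G) → Set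
Edge G i j = (i < j) × (adj G i j ≡ true)

StrictMono : {m n : ℕ} → (Fin m → Fin n) → Set
StrictMono f = ∀ i j → i < j → f i < f j

CopyWith : (H F : OrdGraph) → (Fin (size F) → Fin (size F) → Set) → Set
CopyWith H F P =
  Σ (Fin (size H) → Fin (size F)) λ f →
    StrictMono f × (∀ i j → Edge H i j → Edge F (f i) (f j) × P (f i) (f j))

-- A red/blue colouring of the edges of F: the colour of the edge {u,v},
-- u < v, is c u v (true = red, false = blue).
Colouring : OrdGraph → Set
Colouring F = Fin (size F) → Fin (size F) → Bool

RedCopy : (H F : OrdGraph) → Colouring F → Set
RedCopy H F c = CopyWith H F (λ u v → c u v ≡ true)

BlueCopy : (H F : OrdGraph) → Colouring F → Set
BlueCopy H F c = CopyWith H F (λ u v → c u v ≡ false)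

Arrows : (F H H' : OrdGraph) → Set
Arrows F H H' = ∀ (c : Colouring F) → RedCopy H F c ⊎ BlueCopy H' F c

SubgraphEmb : (G F : OrdGraph) → Set
SubgraphEmb G F =
  Σ (Fin (size G) → Fin (size F)) λ g →
    StrictMono g × (∀ i j → Edge G i j → Edge F (g i) (g j))

Proper : (G F : OrdGraph) → SubgraphEmb G F → Set
Proper G F (g , _) =
  (Σ (Fin (size F)) λ v → ∀ i → g i ≢ v)
  ⊎ (Σ (Fin (size G)) λ i → Σ (Fin (size G)) λ j →
       Edge F (g i) (g j) × ¬ Edge G i j)

ProperSubgraph : (G F : OrdGraph) → Set
ProperSubgraph G F = Σ (SubgraphEmb G F) (Proper G F)

Minimal : (F H H' : OrdGraph) → Set
Minimal F H H' =
  Arrows F H H' × (∀ (G : OrdGraph) → ProperSubgraph G F → ¬ Arrows G H H')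

OrdIso : (G F : OrdGraph) → Set
OrdIso G F =
  Σ (Fin (size G) → Fin (size F)) λ f →
    StrictMono f
    × (∀ v → ∃ λ i → f i ≡ v)
    × (∀ i j → (Edge G i j → Edge F (f i) (f j)) × (Edge F (f i) (f j) → Edge G i j))

RamseyFinite : (H H' : OrdGraph) → Set
RamseyFinite H H' =
  Σ (List OrdGraph) λ L →
    ∀ (F : OrdGraph) → Minimal F H H' → Σ OrdGraph λ G → (G ∈ L) × OrdIso F G

LooselyConnected : OrdGraph → Set
LooselyConnected G =
  (2 ≤ℕ size G)
  × (∀ k → 1 ≤ℕ k → k <ℕ size G →
       Σ (Fin (size G)) λ i → Σ (Fin (size G)) λ j →
         (toℕ i <ℕ k) × (k ≤ℕ toℕ j) × Edge G i j)

unionAdj : (m n : ℕ) → (Fin m → Fin m → Bool) → (Fin n → Fin n → Bool)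
         → Fin (m + n) → Fin (m + n) → Bool
unionAdj m n a b x y with splitAt m x | splitAt m y
... | inj₁ x₁ | inj₁ y₁ = a x₁ y₁
... | inj₂ x₂ | inj₂ y₂ = b x₂ y₂
... | inj₁ _  | inj₂ _  = false
... | inj₂ _  | inj₁ _  = false

_⊔_ : OrdGraph → OrdGraph → OrdGraph
G ⊔ G' = mkOG (size G + size G') (unionAdj (size G) (size G') (adj G) (adj G'))

emptyOG : OrdGraph
emptyOG = mkOG 0 (λ ())

⨆ : (k : ℕ) → (Fin k → OrdGraph) → OrdGraph
⨆ zero H = emptyOG
⨆ (suc zero) H = H zero
⨆ (suc (suc k)) H = H zero ⊔ ⨆ (suc k) (λ i → H (suc i))

module Submission where

-- Let F arrow (H₁ ⊔ ⋯ ⊔ H_s, H′₁ ⊔ ⋯ ⊔ H′_t), let [q₀, p] be the shortest interval of F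
-- arrowing (H₁, H′₁), and let c₁ colour [q₀, p) with neither a red H₁ nor a blue H′₁.
-- Colour F like c₁ left of p, like an arbitrary c₂ right of p, and red on every edge that
-- meets or crosses p.  A red H₁ ⊔ ⋯ must then put H₂ ⊔ ⋯ right of p, and a blue H′₁, being
-- loosely connected, cannot straddle p and so lies right of p as well.  Hence the vertices
-- right of p arrow both (H₂ ⊔ ⋯, H′₁ ⊔ ⋯) and (H₁ ⊔ ⋯, H′₂ ⊔ ⋯).  A minimal arrowing
-- subgraph of [q₀, p] is isomorphic to one of the finitely many minimal graphs for
-- (H₁, H′₁), so by induction F contains an arrowing vertex set of bounded size.  A minimal
-- F has no vertex outside such a set, so its size is bounded, and there are only finitely
-- many such F.  The argument is classical: it runs in the double-negation monad and
-- returns to constructive statements through the decidability of monochromatic copies.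

open import Defs
open import Data.Nat using (ℕ; _≤_)
open import Data.Fin using (Fin)

open import Data.Bool using (Bool; true; false; not; if_then_else_; _∧_; _≟_)
open import Data.Bool.Properties using (not-¬)
open import Data.Empty using (⊥-elim)
open import Data.Fin using (zero; suc; toℕ; fromℕ; fromℕ<; punchIn; punchOut; splitAt; _↑ˡ_; _↑ʳ_)
import Data.Fin.Properties as Fin
open import Data.List using (List; []; _∷_; _++_; length; lookup; map; concatMap; allFin; tabulate)
open import Data.List.Membership.Propositional using (_∈_; find)
open import Data.List.Membership.Propositional.Properties
  using (∈-allFin; ∈-map⁺; ∈-map⁻; ∈-++⁺ˡ; ∈-++⁺ʳ; ∈-++⁻)
import Data.List.Membership.DecPropositional as DecMembership
open import Data.List.Properties using (length-++; length-map; length-tabulate)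
open import Data.List.Relation.Unary.Any as Any using (Any; here; there)
import Data.List.Relation.Unary.Any.Properties as Anyₚ
open import Data.Nat using (zero; suc; _+_; _∸_; _<_; z≤n; s≤s; _<?_; _≤?_)
import Data.Nat as ℕ using (_⊔_)
import Data.Nat.Properties as ℕ
open import Data.Product using (Σ; ∃; _×_; _,_; proj₁; proj₂; map₁)
open import Data.Sum using (_⊎_; inj₁; inj₂; [_,_]′)
import Data.Sum as Sum
open import Data.Unit using (⊤; tt)
import Data.Vec.Functional as Vector
open import Effect.Monad using (RawMonad)
open import Function using (_∘_; id; case_of_)
open import Function.Definitions using (Injective)
open import Level using (0ℓ)
open import Relation.Binary using (tri<; tri≈; tri>)
open import Relation.Binary.PropositionalEquality
open import Relation.Nullary using (¬_; Dec; yes; no; does)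
open import Relation.Nullary.Decidable
  using (¬¬-excluded-middle; decidable-stable; dec-true; map′; _×-dec_; _→-dec_; _⊎-dec_)
open import Relation.Nullary.Negation using (¬¬-Monad)
open import Relation.Unary using (Pred; Decidable; _⊆_; _∩_)

open RawMonad (¬¬-Monad {0ℓ}) using (_>>=_; _<$>_; pure)

private
  variable
    m n : ℕ
    A B : Set
    F H K M X Y : OrdGraph

least-below : (P : ℕ → Set) (n : ℕ) →
  ¬ ¬ ((Σ ℕ λ q → q < n × P q × (∀ r → r < q → ¬ P r)) ⊎ (∀ r → r < n → ¬ P r))
least-below P zero = pure (inj₂ λ _ ())
least-below P (suc n) = do
  inj₂ none ← least-below P n
    where inj₁ (q , q<n , pq , least) → pure (inj₁ (q , ℕ.m<n⇒m<1+n q<n , pq , least))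
  yes pn ← ¬¬-excluded-middle
    where no ¬pn → pure (inj₂ λ r r<1+n → [ none r , (λ { refl → ¬pn }) ]′ (ℕ.m<1+n⇒m<n∨m≡n r<1+n))
  pure (inj₁ (n , ℕ.n<1+n n , pn , none))

¬¬-least : (P : ℕ → Set) {n : ℕ} → P n →
  ¬ ¬ (Σ ℕ λ q → q ≤ n × P q × (∀ r → r < q → ¬ P r))
¬¬-least P {n} pn = do
  inj₁ (q , q<1+n , pq , least) ← least-below P (suc n)
    where inj₂ none → λ _ → none n (ℕ.n<1+n n) pn
  pure (q , ℕ.≤-pred q<1+n , pq , least)

VertexSet : OrdGraph → Set₁
VertexSet F = Pred (Fin (size F)) 0ℓ

Below From : ℕ → Pred (Fin n) 0ℓ
Below q u = toℕ u < q
From q u = q ≤ toℕ u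

Between : ℕ → ℕ → Pred (Fin n) 0ℓ
Between q₀ q = From q₀ ∩ Below q

Between? : (q₀ q : ℕ) → Decidable (Between {n} q₀ q)
Between? q₀ q u = (q₀ ≤? toℕ u) ×-dec (toℕ u <? q)

strictMono⇒mono : {f : Fin m → Fin n} → StrictMono f →
  ∀ {i j} → toℕ i ≤ toℕ j → toℕ (f i) ≤ toℕ (f j)
strictMono⇒mono {f = f} mono {i} i≤j with ℕ.m≤n⇒m<n∨m≡n i≤j
... | inj₁ i<j = ℕ.<⇒≤ (mono i _ i<j)
... | inj₂ i≡j = ℕ.≤-reflexive (cong (toℕ ∘ f) (Fin.toℕ-injective i≡j))

strictMono⇒injective : {f : Fin m → Fin n} → StrictMono f → Injective _≡_ _≡_ f
strictMono⇒injective mono {i} {j} fi≡fj with ℕ.<-cmp (toℕ i) (toℕ j)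
... | tri< i<j _ _ = ⊥-elim (ℕ.<-irrefl (cong toℕ fi≡fj) (mono i j i<j))
... | tri≈ _ i≡j _ = Fin.toℕ-injective i≡j
... | tri> _ _ j<i = ⊥-elim (ℕ.<-irrefl (cong toℕ (sym fi≡fj)) (mono j i j<i))

strictMono-reflects : {f : Fin m → Fin n} → StrictMono f →
  ∀ i j → toℕ (f i) < toℕ (f j) → toℕ i < toℕ j
strictMono-reflects mono i j fi<fj with ℕ.<-cmp (toℕ i) (toℕ j)
... | tri< i<j _ _ = i<j
... | tri≈ _ i≡j _ = ⊥-elim (ℕ.<-irrefl (cong toℕ (cong _ (Fin.toℕ-injective i≡j))) fi<fj)
... | tri> _ _ j<i = ⊥-elim (ℕ.<-asym fi<fj (mono j i j<i))

punchIn-strictMono : (v : Fin (suc n)) → StrictMono (punchIn v)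
punchIn-strictMono v i j i<j = ℕ.≤∧≢⇒< (Fin.punchIn-mono-≤ v i j (ℕ.<⇒≤ i<j))
  (λ eq → ℕ.<-irrefl (cong toℕ (Fin.punchIn-injective v i j (Fin.toℕ-injective eq))) i<j)

data SplitView (m n : ℕ) : Fin (m + n) → Set where
  left  : ∀ i → SplitView m n (i ↑ˡ n)
  right : ∀ j → SplitView m n (m ↑ʳ j)

splitView : ∀ m n x → SplitView m n x
splitView m n x with splitAt m x in eq
... | inj₁ i = subst (SplitView m n) (Fin.splitAt⁻¹-↑ˡ eq) (left i)
... | inj₂ j = subst (SplitView m n) (Fin.splitAt⁻¹-↑ʳ eq) (right j)

↑ˡ<↑ʳ : (i : Fin m) (j : Fin n) → toℕ (i ↑ˡ n) < toℕ (m ↑ʳ j)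
↑ˡ<↑ʳ {m} {n} i j = subst₂ _<_ (sym (Fin.toℕ-↑ˡ i n)) (sym (Fin.toℕ-↑ʳ m j))
  (ℕ.<-≤-trans (Fin.toℕ<n i) (ℕ.m≤m+n m (toℕ j)))

↑ˡ-< : {i j : Fin m} → toℕ i < toℕ j → toℕ (i ↑ˡ n) < toℕ (j ↑ˡ n)
↑ˡ-< {n = n} {i} {j} = subst₂ _<_ (sym (Fin.toℕ-↑ˡ i n)) (sym (Fin.toℕ-↑ˡ j n))

↑ˡ-<⁻ : {i j : Fin m} → toℕ (i ↑ˡ n) < toℕ (j ↑ˡ n) → toℕ i < toℕ j
↑ˡ-<⁻ {n = n} {i} {j} = subst₂ _<_ (Fin.toℕ-↑ˡ i n) (Fin.toℕ-↑ˡ j n)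

↑ʳ-< : {i j : Fin n} → toℕ i < toℕ j → toℕ (m ↑ʳ i) < toℕ (m ↑ʳ j)
↑ʳ-< {m = m} {i} {j} = subst₂ _<_ (sym (Fin.toℕ-↑ʳ m i)) (sym (Fin.toℕ-↑ʳ m j)) ∘ ℕ.+-monoʳ-< m

↑ʳ-<⁻ : {i j : Fin n} → toℕ (m ↑ʳ i) < toℕ (m ↑ʳ j) → toℕ i < toℕ j
↑ʳ-<⁻ {m = m} {i} {j} = ℕ.+-cancelˡ-< m _ _ ∘ subst₂ _<_ (Fin.toℕ-↑ʳ m i) (Fin.toℕ-↑ʳ m j)

split-point : {k : ℕ} {f : Fin (m + n) → Fin k} → StrictMono f →
  Σ ℕ λ q → (∀ i → toℕ (f (i ↑ˡ n)) < q) × (∀ j → q ≤ toℕ (f (m ↑ʳ j)))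
split-point {zero} mono = 0 , (λ ()) , λ _ → z≤n
split-point {suc m} {n} {f = f} mono =
  suc (toℕ (f (last ↑ˡ n))) , (λ i → s≤s (strictMono⇒mono mono (≤last i))) , λ j → mono _ _ (↑ˡ<↑ʳ last j)
  where
  last = fromℕ m
  ≤last : ∀ i → toℕ (i ↑ˡ n) ≤ toℕ (last ↑ˡ n)
  ≤last i rewrite Fin.toℕ-↑ˡ i n | Fin.toℕ-↑ˡ last n | Fin.toℕ-fromℕ m = ℕ.≤-pred (Fin.toℕ<n i)

-- Monochromatic copies inside a vertex set

record MonoCopy (H F : OrdGraph) (c : Colouring F) (b : Bool) (P : VertexSet F) : Set where
  constructor monoCopy
  field
    embed  : Fin (size H) → Fin (size F)
    mono   : StrictMono embed
    edges  : ∀ i j → Edge H i j → Edge F (embed i) (embed j) × c (embed i) (embed j) ≡ b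
    inside : ∀ i → P (embed i)

module _ {c : Colouring F} {b : Bool} where

  monoCopy-weaken : {P Q : VertexSet F} → P ⊆ Q → MonoCopy H F c b P → MonoCopy H F c b Q
  monoCopy-weaken P⊆Q (monoCopy f mono edges inP) = monoCopy f mono edges (P⊆Q ∘ inP)

  monoCopy-∩ : {P Q : VertexSet F} (copy : MonoCopy H F c b P) →
    (∀ i → Q (MonoCopy.embed copy i)) → MonoCopy H F c b (P ∩ Q)
  monoCopy-∩ (monoCopy f mono edges inP) inQ = monoCopy f mono edges λ i → inP i , inQ i

  monoCopy-recolour : {P : VertexSet F} {c′ : Colouring F} →
    (∀ {u w} → P u → P w → c u w ≡ c′ u w) → MonoCopy H F c b P → MonoCopy H F c′ b P
  monoCopy-recolour agree (monoCopy f mono edges inP) =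
    monoCopy f mono (λ i j e → proj₁ (edges i j e) , trans (sym (agree (inP i) (inP j))) (proj₂ (edges i j e)))
             inP

MonoSequence : (A → OrdGraph) → (F : OrdGraph) → List A → Colouring F → Bool → VertexSet F → Set
MonoSequence G F [] c b P = ⊤
MonoSequence G F (x ∷ xs) c b P =
  Σ ℕ λ q → MonoCopy (G x) F c b (P ∩ Below q) × MonoSequence G F xs c b (P ∩ From q)

module _ (G : A → OrdGraph) {c : Colouring F} {b : Bool} where

  sequence-weaken : ∀ xs {P Q : VertexSet F} → P ⊆ Q →
    MonoSequence G F xs c b P → MonoSequence G F xs c b Q
  sequence-weaken [] P⊆Q _ = tt
  sequence-weaken (x ∷ xs) P⊆Q (q , copy , rest) =
    q , monoCopy-weaken (map₁ P⊆Q) copy , sequence-weaken xs (map₁ P⊆Q) rest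

  sequence-recolour : ∀ xs {P : VertexSet F} {c′ : Colouring F} →
    (∀ {u w} → P u → P w → c u w ≡ c′ u w) → MonoSequence G F xs c b P → MonoSequence G F xs c′ b P
  sequence-recolour [] agree _ = tt
  sequence-recolour (x ∷ xs) agree (q , copy , rest) =
    q , monoCopy-recolour (λ u w → agree (proj₁ u) (proj₁ w)) copy
      , sequence-recolour xs (λ u w → agree (proj₁ u) (proj₁ w)) rest

-- Arrowing only up to double negation is what makes the least-interval and
-- minimal-subgraph arguments available.
ArrowsIn : (F X Y : OrdGraph) → VertexSet F → Set
ArrowsIn F X Y P = ∀ c → ¬ ¬ (MonoCopy X F c true P ⊎ MonoCopy Y F c false P)

SequencesArrowIn : (F : OrdGraph) → (A → OrdGraph) → (B → OrdGraph) →
  Bool → List A → List B → VertexSet F → Set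
SequencesArrowIn F G G′ b xs ys P =
  ∀ c → ¬ ¬ (MonoSequence G F xs c b P ⊎ MonoSequence G′ F ys c (not b) P)

arrowsIn-weaken : {P Q : VertexSet F} → P ⊆ Q → ArrowsIn F X Y P → ArrowsIn F X Y Q
arrowsIn-weaken P⊆Q arrows c = Sum.map (monoCopy-weaken P⊆Q) (monoCopy-weaken P⊆Q) <$> arrows c

sequencesArrowIn-weaken : (G : A → OrdGraph) (G′ : B → OrdGraph) → ∀ {b} xs ys {P Q : VertexSet F} →
  P ⊆ Q → SequencesArrowIn F G G′ b xs ys P → SequencesArrowIn F G G′ b xs ys Q
sequencesArrowIn-weaken G G′ xs ys P⊆Q arrows c =
  Sum.map (sequence-weaken G xs P⊆Q) (sequence-weaken G′ ys P⊆Q) <$> arrows c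

sequencesArrowIn-swap : (G : A → OrdGraph) (G′ : B → OrdGraph) → ∀ b {xs ys} {P : VertexSet F} →
  SequencesArrowIn F G G′ b xs ys P → SequencesArrowIn F G′ G (not b) ys xs P
sequencesArrowIn-swap G G′ true arrows c = Sum.swap <$> arrows c
sequencesArrowIn-swap G G′ false arrows c = Sum.swap <$> arrows c

arrowsIn-inhabited : {P : VertexSet F} → Fin (size X) → Fin (size Y) → ArrowsIn F X Y P → ¬ ¬ ∃ P
arrowsIn-inhabited v v′ arrows =
  [ (λ red → _ , MonoCopy.inside red v) , (λ blue → _ , MonoCopy.inside blue v′) ]′ <$> arrows (λ _ _ → true)

arrowsIn-interval : ∀ {q₀ q} → Fin (size X) → Fin (size Y) → ArrowsIn F X Y (Between q₀ q) → q₀ < q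
arrowsIn-interval {q₀ = q₀} {q} v v′ arrows = decidable-stable (q₀ <? q) do
  (_ , q₀≤u , u<q) ← arrowsIn-inhabited v v′ arrows
  pure (ℕ.≤-<-trans q₀≤u u<q)

-- Intervally disjoint unions

module _ {X Y : OrdGraph} where

  ⊔-adj-left : ∀ i j → adj (X ⊔ Y) (i ↑ˡ size Y) (j ↑ˡ size Y) ≡ adj X i j
  ⊔-adj-left i j rewrite Fin.splitAt-↑ˡ (size X) i (size Y) | Fin.splitAt-↑ˡ (size X) j (size Y) = refl

  ⊔-adj-right : ∀ i j → adj (X ⊔ Y) (size X ↑ʳ i) (size X ↑ʳ j) ≡ adj Y i j
  ⊔-adj-right i j rewrite Fin.splitAt-↑ʳ (size X) (size Y) i | Fin.splitAt-↑ʳ (size X) (size Y) j = refl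

  ⊔-adj-cross : ∀ i j → adj (X ⊔ Y) (i ↑ˡ size Y) (size X ↑ʳ j) ≡ false
  ⊔-adj-cross i j rewrite Fin.splitAt-↑ˡ (size X) i (size Y) | Fin.splitAt-↑ʳ (size X) (size Y) j = refl

  ⊔-edge-left : ∀ {i j} → Edge X i j → Edge (X ⊔ Y) (i ↑ˡ size Y) (j ↑ˡ size Y)
  ⊔-edge-left {i} {j} (i<j , a) = ↑ˡ-< i<j , trans (⊔-adj-left i j) a

  ⊔-edge-right : ∀ {i j} → Edge Y i j → Edge (X ⊔ Y) (size X ↑ʳ i) (size X ↑ʳ j)
  ⊔-edge-right {i} {j} (i<j , a) = ↑ʳ-< i<j , trans (⊔-adj-right i j) a

module _ {X Y F : OrdGraph} {c : Colouring F} {b : Bool} {P : VertexSet F} where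

  monoCopy-⊔⁻ : MonoCopy (X ⊔ Y) F c b P →
    Σ ℕ λ q → MonoCopy X F c b (P ∩ Below q) × MonoCopy Y F c b (P ∩ From q)
  monoCopy-⊔⁻ (monoCopy f mono edges inside) =
    q , monoCopy (λ i → f (i ↑ˡ size Y)) (λ i j → mono _ _ ∘ ↑ˡ-<) (λ i j → edges _ _ ∘ ⊔-edge-left)
                 (λ i → inside _ , proj₁ (proj₂ split) i)
      , monoCopy (λ j → f (size X ↑ʳ j)) (λ i j → mono _ _ ∘ ↑ʳ-<) (λ i j → edges _ _ ∘ ⊔-edge-right)
                 (λ j → inside _ , proj₂ (proj₂ split) j)
    where
    split = split-point {m = size X} mono
    q = proj₁ split

  monoCopy-⊔⁺ : ∀ q → MonoCopy X F c b (P ∩ Below q) → MonoCopy Y F c b (P ∩ From q) →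
    MonoCopy (X ⊔ Y) F c b P
  monoCopy-⊔⁺ q (monoCopy fX monoX edgesX inX) (monoCopy fY monoY edgesY inY) =
    monoCopy f mono edges inside
    where
    f : Fin (size X + size Y) → Fin (size F)
    f = [ fX , fY ]′ ∘ splitAt (size X)

    f-left : ∀ i → f (i ↑ˡ size Y) ≡ fX i
    f-left i rewrite Fin.splitAt-↑ˡ (size X) i (size Y) = refl

    f-right : ∀ j → f (size X ↑ʳ j) ≡ fY j
    f-right j rewrite Fin.splitAt-↑ʳ (size X) (size Y) j = refl

    mono : StrictMono f
    mono x y x<y with splitView (size X) (size Y) x | splitView (size X) (size Y) y
    ... | left i  | left j  rewrite f-left i  | f-left j  = monoX i j (↑ˡ-<⁻ x<y)
    ... | left i  | right j rewrite f-left i  | f-right j = ℕ.<-≤-trans (proj₂ (inX i)) (proj₂ (inY j))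
    ... | right i | left j  = ⊥-elim (ℕ.<-asym x<y (↑ˡ<↑ʳ j i))
    ... | right i | right j rewrite f-right i | f-right j = monoY i j (↑ʳ-<⁻ x<y)

    edges : ∀ x y → Edge (X ⊔ Y) x y → Edge F (f x) (f y) × c (f x) (f y) ≡ b
    edges x y (x<y , a) with splitView (size X) (size Y) x | splitView (size X) (size Y) y
    ... | left i  | left j  rewrite f-left i  | f-left j  =
      edgesX i j (↑ˡ-<⁻ x<y , trans (sym (⊔-adj-left {X = X} {Y} i j)) a)
    ... | left i  | right j = case trans (sym (⊔-adj-cross {X = X} {Y} i j)) a of λ ()
    ... | right i | left j  = ⊥-elim (ℕ.<-asym x<y (↑ˡ<↑ʳ j i))
    ... | right i | right j rewrite f-right i | f-right j =
      edgesY i j (↑ʳ-<⁻ x<y , trans (sym (⊔-adj-right {X = X} {Y} i j)) a)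

    inside : ∀ x → P (f x)
    inside x with splitView (size X) (size Y) x
    ... | left i  rewrite f-left i  = proj₁ (inX i)
    ... | right j rewrite f-right j = proj₁ (inY j)

module _ (G : A → OrdGraph) {F : OrdGraph} {c : Colouring F} {b : Bool} where

  monoCopy-⨆⇒sequence : ∀ k (g : Fin (suc k) → A) {P : VertexSet F} →
    MonoCopy (⨆ (suc k) (G ∘ g)) F c b P → MonoSequence G F (tabulate g) c b P
  monoCopy-⨆⇒sequence zero g copy = size F , monoCopy-weaken (λ {u} Pu → Pu , Fin.toℕ<n u) copy , tt
  monoCopy-⨆⇒sequence (suc k) g copy =
    let (q , first , rest) = monoCopy-⊔⁻ copy in q , first , monoCopy-⨆⇒sequence k (g ∘ suc) rest

  sequence⇒monoCopy-⨆ : ∀ k (g : Fin (suc k) → A) {P : VertexSet F} →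
    MonoSequence G F (tabulate g) c b P → MonoCopy (⨆ (suc k) (G ∘ g)) F c b P
  sequence⇒monoCopy-⨆ zero g (q , copy , _) = monoCopy-weaken proj₁ copy
  sequence⇒monoCopy-⨆ (suc k) g (q , first , rest) =
    monoCopy-⊔⁺ q first (sequence⇒monoCopy-⨆ k (g ∘ suc) rest)

-- Loose connectivity and splicing

module _ {H : OrdGraph} (connected : LooselyConnected H) where

  firstVertex : Fin (size H)
  firstVertex = fromℕ< (ℕ.<-trans (s≤s z≤n) (proj₁ connected))

  firstVertex-least : (i : Fin (size H)) → toℕ firstVertex ≤ toℕ i
  firstVertex-least i = subst (_≤ toℕ i) (sym (Fin.toℕ-fromℕ< _)) z≤n

  -- Every proper initial interval sends an edge to its complement.
  looselyConnected-closed : (Q : Pred (Fin (size H)) 0ℓ) →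
    (∀ {i j} → toℕ i ≤ toℕ j → Q j → Q i) → (∀ {i j} → Edge H i j → Q i → Q j) →
    Q firstVertex → ∀ i → Q i
  looselyConnected-closed Q down along Q₀ i =
    down (ℕ.≤-reflexive (sym (Fin.toℕ-fromℕ< (Fin.toℕ<n i)))) (prefix (toℕ i) (Fin.toℕ<n i))
    where
    prefix : ∀ k (k<n : k < size H) → Q (fromℕ< k<n)
    prefix zero k<n = Q₀
    prefix (suc k) k<n with proj₂ connected (suc k) (s≤s z≤n) k<n
    ... | i , j , i≤k , k<j , edge =
      down (ℕ.≤-trans (ℕ.≤-reflexive (Fin.toℕ-fromℕ< k<n)) k<j)
        (along edge (down (ℕ.≤-trans (ℕ.≤-pred i≤k) (ℕ.≤-reflexive (sym (Fin.toℕ-fromℕ< _))))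
                          (prefix k (ℕ.<-trans (ℕ.n<1+n k) k<n))))

SameSide : ℕ → Fin n → Fin n → Set
SameSide p u w = (toℕ u < p × toℕ w < p) ⊎ (p < toℕ u × p < toℕ w)

copy-on-one-side : {H : OrdGraph} → LooselyConnected H → {f : Fin (size H) → Fin n} → StrictMono f →
  (p : ℕ) → (∀ {i j} → Edge H i j → SameSide p (f i) (f j)) →
  (∀ i → toℕ (f i) < p) ⊎ (∀ i → p < toℕ (f i))
copy-on-one-side {H = H} connected {f} mono p same with toℕ (f (firstVertex connected)) <? p
... | yes first<p =
  inj₁ (looselyConnected-closed connected (λ i → toℕ (f i) < p)
          (λ i≤j → ℕ.≤-<-trans (strictMono⇒mono mono i≤j)) along first<p)
  where
  along : ∀ {i j} → Edge H i j → toℕ (f i) < p → toℕ (f j) < p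
  along edge fi<p with same edge
  ... | inj₁ (_ , fj<p) = fj<p
  ... | inj₂ (p<fi , _) = ⊥-elim (ℕ.<-asym fi<p p<fi)
... | no first≮p with proj₂ connected 1 ℕ.≤-refl (proj₁ connected)
... | i , j , i<1 , _ , edge =
  inj₂ λ k → ℕ.<-≤-trans p<first (strictMono⇒mono mono (firstVertex-least connected k))
  where
  p<first : p < toℕ (f (firstVertex connected))
  p<first with same edge
  ... | inj₁ (fi<p , _) =
    ⊥-elim (first≮p (ℕ.≤-<-trans (strictMono⇒mono mono (firstVertex-least connected i)) fi<p))
  ... | inj₂ (p<fi , _) = ℕ.<-≤-trans p<fi (strictMono⇒mono mono (ℕ.≤-trans (ℕ.≤-pred i<1) z≤n))

splice : (Fin n → Fin n → Bool) → (Fin n → Fin n → Bool) → ℕ → Bool → Fin n → Fin n → Bool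
splice c₁ c₂ p b u w with (toℕ u <? p) ×-dec (toℕ w <? p) | (p <? toℕ u) ×-dec (p <? toℕ w)
... | yes _ | _     = c₁ u w
... | no _  | yes _ = c₂ u w
... | no _  | no _  = b

module _ {c₁ c₂ : Fin n → Fin n → Bool} {p : ℕ} {b : Bool} {u w : Fin n} where

  splice-below : toℕ u < p → toℕ w < p → splice c₁ c₂ p b u w ≡ c₁ u w
  splice-below u<p w<p with (toℕ u <? p) ×-dec (toℕ w <? p) | (p <? toℕ u) ×-dec (p <? toℕ w)
  ... | yes _ | _ = refl
  ... | no ¬below | _ = ⊥-elim (¬below (u<p , w<p))

  splice-above : p < toℕ u → p < toℕ w → splice c₁ c₂ p b u w ≡ c₂ u w
  splice-above p<u p<w with (toℕ u <? p) ×-dec (toℕ w <? p) | (p <? toℕ u) ×-dec (p <? toℕ w)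
  ... | yes (u<p , _) | _ = ⊥-elim (ℕ.<-asym u<p p<u)
  ... | no _ | yes _ = refl
  ... | no _ | no ¬above = ⊥-elim (¬above (p<u , p<w))

  splice-≢ : splice c₁ c₂ p b u w ≢ b → SameSide p u w
  splice-≢ ≢b with (toℕ u <? p) ×-dec (toℕ w <? p) | (p <? toℕ u) ×-dec (p <? toℕ w)
  ... | yes below | _ = inj₁ below
  ... | no _ | yes above = inj₂ above
  ... | no _ | no _ = ⊥-elim (≢b refl)

module _ {F : OrdGraph} {c₁ c₂ : Colouring F} {b : Bool} {q₀ : ℕ} (p : ℕ) where

  private
    c : Colouring F
    c = splice c₁ c₂ p b

    c≡c₁ : ∀ {u w} → Between q₀ p u → Between q₀ p w → c u w ≡ c₁ u w
    c≡c₁ u w = splice-below (proj₂ u) (proj₂ w)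

    c≡c₂ : {P : VertexSet F} → ∀ {u w} → (From (suc p) ∩ P) u → (From (suc p) ∩ P) w → c u w ≡ c₂ u w
    c≡c₂ u w = splice-above (proj₁ u) (proj₁ w)

  -- If the second copy reached back to p, the first copy would lie in [q₀, p).
  drop-first-beyond-gap : {G : A → OrdGraph} {x x₂ : A} {xs : List A} → LooselyConnected (G x₂) →
    ¬ MonoCopy (G x) F c₁ b (Between q₀ p) →
    MonoSequence G F (x ∷ x₂ ∷ xs) c b (From q₀) → MonoSequence G F (x₂ ∷ xs) c₂ b (From (suc p))
  drop-first-beyond-gap {G = G} {xs = xs} connected no-first (q , first , q′ , second , rest)
    with Fin.all? (λ i → suc p ≤? toℕ (MonoCopy.embed second i))
  ... | yes second-right =
    q′ , monoCopy-recolour c≡c₂ (monoCopy-weaken (λ (inside , p<u) → p<u , proj₂ inside)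
                                                  (monoCopy-∩ second second-right))
       , sequence-recolour G xs c≡c₂ (sequence-weaken G xs (λ (_ , q′≤u) → ℕ.<-≤-trans p<q′ q′≤u , q′≤u) rest)
    where
    p<q′ : p < q′
    p<q′ = ℕ.<-trans (second-right v) (proj₂ (MonoCopy.inside second v))
      where v = firstVertex connected
  ... | no ¬second-right with Fin.¬∀⟶∃¬ _ _ (λ i → suc p ≤? toℕ (MonoCopy.embed second i)) ¬second-right
  ... | i , ¬right =
    ⊥-elim (no-first (monoCopy-recolour c≡c₁ (monoCopy-weaken (λ (q₀≤u , u<q) → q₀≤u , ℕ.<-≤-trans u<q q≤p)
                                                               first)))
    where
    q≤p : q ≤ p
    q≤p = ℕ.≤-trans (proj₂ (proj₁ (MonoCopy.inside second i))) (ℕ.≮⇒≥ ¬right)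

  -- Edges of colour not b never cross p, so a connected first copy lies on one side of p.
  whole-beyond-gap : {G′ : B → OrdGraph} {y : B} {ys : List B} → LooselyConnected (G′ y) →
    ¬ MonoCopy (G′ y) F c₁ (not b) (Between q₀ p) →
    MonoSequence G′ F (y ∷ ys) c (not b) (From q₀) → MonoSequence G′ F (y ∷ ys) c₂ (not b) (From (suc p))
  whole-beyond-gap {G′ = G′} {ys = ys} connected no-first (q , first , rest)
    with copy-on-one-side connected (MonoCopy.mono first) p
           (λ {i} {j} e → splice-≢ λ c≡b → not-¬ refl (trans (sym c≡b) (proj₂ (MonoCopy.edges first i j e))))
  ... | inj₁ all-left =
    ⊥-elim (no-first (monoCopy-recolour c≡c₁ (monoCopy-weaken (λ ((q₀≤u , _) , u<p) → q₀≤u , u<p)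
                                                               (monoCopy-∩ first all-left))))
  ... | inj₂ all-right =
    q , monoCopy-recolour c≡c₂ (monoCopy-weaken (λ ((_ , u<q) , p<u) → p<u , u<q) (monoCopy-∩ first all-right))
      , sequence-recolour G′ ys c≡c₂ (sequence-weaken G′ ys (λ (_ , q≤u) → ℕ.<-≤-trans p<q q≤u , q≤u) rest)
    where
    p<q : p < q
    p<q = ℕ.<-trans (all-right v) (proj₂ (MonoCopy.inside first v))
      where v = firstVertex connected

module _ {G : A → OrdGraph} {G′ : B → OrdGraph}
         (connected : ∀ x → LooselyConnected (G x)) (connected′ : ∀ y → LooselyConnected (G′ y)) where

  -- c₁ shows that [q₀, p) does not arrow (G x, G′ y); splice it with any c₂ right of p.
  arrows-beyond-gap : ∀ b {x xs y ys q₀} p →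
    SequencesArrowIn F G G′ b (x ∷ xs) (y ∷ ys) (From q₀) → (c₁ : Colouring F) →
    ¬ MonoCopy (G x) F c₁ b (Between q₀ p) → ¬ MonoCopy (G′ y) F c₁ (not b) (Between q₀ p) →
    SequencesArrowIn F G G′ b xs (y ∷ ys) (From (suc p))
  arrows-beyond-gap b {xs = []} p _ _ _ _ _ = pure (inj₁ tt)
  arrows-beyond-gap b {xs = x₂ ∷ xs} {y} p arrows c₁ no-x no-y c₂ =
    Sum.map (drop-first-beyond-gap p (connected x₂) no-x) (whole-beyond-gap p (connected′ y) no-y)
      <$> arrows (splice c₁ c₂ p b)

-- Small arrowing vertex sets

module _ {G : A → OrdGraph} {G′ : B → OrdGraph} where

  sequences-glue : ∀ {x xs y ys} {P : VertexSet F} p →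
    ArrowsIn F (G x) (G′ y) (P ∩ Below p) →
    SequencesArrowIn F G G′ true xs (y ∷ ys) (P ∩ From p) →
    SequencesArrowIn F G G′ true (x ∷ xs) ys (P ∩ From p) →
    SequencesArrowIn F G G′ true (x ∷ xs) (y ∷ ys) P
  sequences-glue {x = x} {xs} {y} {ys} p heads rest-x rest-y c = heads c >>= [ red-first , blue-first ]′
    where
    red-first : MonoCopy (G x) _ c true _ → ¬ ¬ _
    red-first red-x =
      Sum.map (λ red-xs → p , red-x , red-xs) (sequence-weaken G′ (y ∷ ys) proj₁) <$> rest-x c
    blue-first : MonoCopy (G′ y) _ c false _ → ¬ ¬ _
    blue-first blue-y =
      Sum.map (sequence-weaken G (x ∷ xs) proj₁) (λ blue-ys → p , blue-y , blue-ys) <$> rest-y c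

SmallWitness : (F : OrdGraph) → ℕ → VertexSet F → (VertexSet F → Set) → Set
SmallWitness F k P Q = Σ (List (Fin (size F))) λ S → length S ≤ k × (_∈ S) ⊆ P × Q (_∈ S)

SmallCores : (X Y : OrdGraph) → ℕ → Set
SmallCores X Y k = ∀ F {q₀ q} → q ≤ size F → ArrowsIn F X Y (Between q₀ q) →
  ¬ ¬ SmallWitness F k (Between q₀ q) (ArrowsIn F X Y)

sequenceBound : (A → B → ℕ) → List A → List B → ℕ
sequenceBound k [] ys = 0
sequenceBound k (x ∷ xs) [] = 0
sequenceBound k (x ∷ xs) (y ∷ ys) = k x y + (sequenceBound k xs (y ∷ ys) + sequenceBound k (x ∷ xs) ys)

module _ {G : A → OrdGraph} {G′ : B → OrdGraph} {k : A → B → ℕ} where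

  smallWitness-glue : ∀ {x xs y ys q₀} p → q₀ ≤ p →
    SmallWitness F (k x y) (Between q₀ p) (ArrowsIn F (G x) (G′ y)) →
    SmallWitness F (sequenceBound k xs (y ∷ ys)) (From p) (SequencesArrowIn F G G′ true xs (y ∷ ys)) →
    SmallWitness F (sequenceBound k (x ∷ xs) ys) (From p) (SequencesArrowIn F G G′ true (x ∷ xs) ys) →
    SmallWitness F (sequenceBound k (x ∷ xs) (y ∷ ys)) (From q₀)
                 (SequencesArrowIn F G G′ true (x ∷ xs) (y ∷ ys))
  smallWitness-glue {xs = xs} {ys = ys} p q₀≤p
    (S₁ , |S₁| , S₁⊆ , heads) (S₂ , |S₂| , S₂⊆ , rest-x) (S₃ , |S₃| , S₃⊆ , rest-y) =
    S₁ ++ S₂ ++ S₃ , size-bound , ⊆From ,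
    sequences-glue p (arrowsIn-weaken (λ u∈ → ∈₁ u∈ , proj₂ (S₁⊆ u∈)) heads)
                     (sequencesArrowIn-weaken G G′ xs (_ ∷ ys) (λ u∈ → ∈₂ u∈ , S₂⊆ u∈) rest-x)
                     (sequencesArrowIn-weaken G G′ (_ ∷ xs) ys (λ u∈ → ∈₃ u∈ , S₃⊆ u∈) rest-y)
    where
    ∈₁ = λ {u} → ∈-++⁺ˡ {v = u} {xs = S₁} {ys = S₂ ++ S₃}
    ∈₂ = λ {u} (u∈ : u ∈ S₂) → ∈-++⁺ʳ S₁ (∈-++⁺ˡ {ys = S₃} u∈)
    ∈₃ = λ {u} (u∈ : u ∈ S₃) → ∈-++⁺ʳ S₁ (∈-++⁺ʳ S₂ u∈)
    size-bound : length (S₁ ++ S₂ ++ S₃) ≤ _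
    size-bound rewrite length-++ S₁ {S₂ ++ S₃} | length-++ S₂ {S₃} = ℕ.+-mono-≤ |S₁| (ℕ.+-mono-≤ |S₂| |S₃|)
    ⊆From : (_∈ S₁ ++ S₂ ++ S₃) ⊆ From _
    ⊆From u∈ with ∈-++⁻ S₁ u∈
    ... | inj₁ u∈₁ = proj₁ (S₁⊆ u∈₁)
    ... | inj₂ u∈′ = ℕ.≤-trans q₀≤p ([ S₂⊆ , S₃⊆ ]′ (∈-++⁻ S₂ u∈′))

module _ {G : A → OrdGraph} {G′ : B → OrdGraph}
         (connected : ∀ x → LooselyConnected (G x)) (connected′ : ∀ y → LooselyConnected (G′ y))
         {k : A → B → ℕ} (cores : ∀ x y → SmallCores (G x) (G′ y) (k x y)) (F : OrdGraph) where

  SmallWitnesses : List A → List B → Set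
  SmallWitnesses xs ys = ∀ {q₀} → SequencesArrowIn F G G′ true xs ys (From q₀) →
    ¬ ¬ SmallWitness F (sequenceBound k xs ys) (From q₀) (SequencesArrowIn F G G′ true xs ys)

  -- Let [q₀, p] be the shortest interval arrowing (G x, G′ y).  A small core of it,
  -- together with small witnesses for the two shortened pairs of sequences right of p
  -- (which arrow by arrows-beyond-gap), is a small witness for the full pair.
  smallWitnesses-step : ∀ x xs y ys → SmallWitnesses xs (y ∷ ys) → SmallWitnesses (x ∷ xs) ys →
    SmallWitnesses (x ∷ xs) (y ∷ ys)
  smallWitnesses-step x xs y ys shrink-x shrink-y {q₀} arrows = do
    (suc p , p<n , heads , shorter-fails) ← ¬¬-least (λ q → ArrowsIn F (G x) (G′ y) (Between q₀ q)) whole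
      where (zero , _ , heads , _) → λ _ → ℕ.n≮0 (nonempty heads)
    (c₁ , c₁-fails) ← bad-colouring (shorter-fails p (ℕ.n<1+n p))
    core ← cores x y F p<n heads
    rest-x ← shrink-x (arrows-beyond-gap connected connected′ true p arrows
                                         c₁ (c₁-fails ∘ inj₁) (c₁-fails ∘ inj₂))
    rest-y ← shrink-y (sequencesArrowIn-swap G′ G false
                        (arrows-beyond-gap connected′ connected false p (sequencesArrowIn-swap G G′ true arrows)
                                           c₁ (c₁-fails ∘ inj₂) (c₁-fails ∘ inj₁)))
    pure (smallWitness-glue (suc p) (ℕ.<⇒≤ (nonempty heads)) core rest-x rest-y)
    where
    nonempty : ∀ {q} → ArrowsIn F (G x) (G′ y) (Between q₀ q) → q₀ < q
    nonempty = arrowsIn-interval (firstVertex (connected x)) (firstVertex (connected′ y))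
    whole : ArrowsIn F (G x) (G′ y) (Between q₀ (size F))
    whole c = Sum.map (λ (_ , red , _) → monoCopy-weaken within red)
                      (λ (_ , blue , _) → monoCopy-weaken within blue) <$> arrows c
      where
      within : ∀ {q u} → Between q₀ q u → Between q₀ (size F) u
      within (q₀≤u , _) = q₀≤u , Fin.toℕ<n _
    bad-colouring : ∀ {P} → ¬ ArrowsIn F (G x) (G′ y) P →
      ¬ ¬ Σ (Colouring F) λ c → ¬ (MonoCopy (G x) F c true P ⊎ MonoCopy (G′ y) F c false P)
    bad-colouring fails none = fails λ c no → none (c , no)

  sequences-smallWitnesses : ∀ xs ys → SmallWitnesses xs ys
  sequences-smallWitnesses [] ys _ = pure ([] , z≤n , (λ ()) , λ _ → pure (inj₁ tt))
  sequences-smallWitnesses (x ∷ xs) [] _ = pure ([] , z≤n , (λ ()) , λ _ → pure (inj₂ tt))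
  sequences-smallWitnesses (x ∷ xs) (y ∷ ys) =
    smallWitnesses-step x xs y ys (sequences-smallWitnesses xs (y ∷ ys)) (sequences-smallWitnesses (x ∷ xs) ys)

functions : (m : ℕ) → List A → List (Fin m → A)
functions zero xs = (λ ()) ∷ []
functions (suc m) xs = concatMap (λ a → map (a Vector.∷_) (functions m xs)) xs

functions-complete : (R : A → A → Set) {xs : List A} → (∀ a → Any (R a) xs) →
  (f : Fin m → A) → Any (λ g → ∀ i → R (f i) (g i)) (functions m xs)
functions-complete {m = zero} R complete f = here λ ()
functions-complete {m = suc m} R complete f =
  Anyₚ.concatMap⁺ _ (Any.map (λ R₀ → Anyₚ.map⁺ (Any.map (extend R₀) (functions-complete R complete (f ∘ suc))))
                             (complete (f zero)))
  where
  extend : ∀ {a g} → R (f zero) a → (∀ i → R (f (suc i)) (g i)) → ∀ i → R (f i) ((a Vector.∷ g) i)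
  extend R₀ _ zero = R₀
  extend _ Rs (suc i) = Rs i

Edge? : (H : OrdGraph) → ∀ i j → Dec (Edge H i j)
Edge? H i j = (toℕ i <? toℕ j) ×-dec (adj H i j ≟ true)

module _ {H F : OrdGraph} (c : Colouring F) (b : Bool) {P : VertexSet F} (P? : Decidable P) where

  private
    IsCopy : (Fin (size H) → Fin (size F)) → Set
    IsCopy f = StrictMono f × (∀ i j → Edge H i j → Edge F (f i) (f j) × c (f i) (f j) ≡ b) × (∀ i → P (f i))

    isCopy? : ∀ f → Dec (IsCopy f)
    isCopy? f =
      Fin.all? (λ i → Fin.all? λ j → (toℕ i <? toℕ j) →-dec (toℕ (f i) <? toℕ (f j)))
      ×-dec Fin.all? (λ i → Fin.all? λ j → Edge? H i j →-dec (Edge? F (f i) (f j) ×-dec (c (f i) (f j) ≟ b)))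
      ×-dec Fin.all? (P? ∘ f)

    isCopy-cong : ∀ {f g} → (∀ i → f i ≡ g i) → IsCopy f → IsCopy g
    isCopy-cong f≗g (mono , edges , inside) =
      (λ i j i<j → subst₂ (λ u w → toℕ u < toℕ w) (f≗g i) (f≗g j) (mono i j i<j)) ,
      (λ i j e → subst₂ (λ u w → Edge F u w × c u w ≡ b) (f≗g i) (f≗g j) (edges i j e)) ,
      (λ i → subst P (f≗g i) (inside i))

  monoCopy? : Dec (MonoCopy H F c b P)
  monoCopy? = map′ fromAny toAny (Any.any? isCopy? (functions (size H) (allFin (size F))))
    where
    fromAny : Any IsCopy (functions (size H) (allFin (size F))) → MonoCopy H F c b P
    fromAny found with Any.satisfied found
    ... | f , mono , edges , inside = monoCopy f mono edges inside
    toAny : MonoCopy H F c b P → Any IsCopy (functions (size H) (allFin (size F)))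
    toAny (monoCopy f mono edges inside) =
      Any.map (λ f≗g → isCopy-cong f≗g (mono , edges , inside)) (functions-complete _≡_ ∈-allFin f)

-- Subgraphs

induce : (F : OrdGraph) → (Fin m → Fin (size F)) → OrdGraph
induce {m} F e = mkOG m (λ i j → adj F (e i) (e j))

induce-emb : {e : Fin m → Fin (size F)} → StrictMono e → SubgraphEmb (induce F e) F
induce-emb {e = e} mono = e , mono , λ i j (i<j , a) → mono i j i<j , a

subgraphEmb-refl : SubgraphEmb F F
subgraphEmb-refl = id , (λ _ _ i<j → i<j) , λ _ _ e → e

subgraphEmb-∘ : SubgraphEmb M K → SubgraphEmb K F → SubgraphEmb M F
subgraphEmb-∘ (f , mono-f , edges-f) (g , mono-g , edges-g) =
  g ∘ f , (λ i j → mono-g _ _ ∘ mono-f i j) , λ i j → edges-g _ _ ∘ edges-f i j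

subgraphEmb-induce : {e : Fin m → Fin (size F)} → StrictMono e → (emb : SubgraphEmb H F) →
  (h : Fin (size H) → Fin m) → (∀ i → e (h i) ≡ proj₁ emb i) → SubgraphEmb H (induce F e)
subgraphEmb-induce {F = F} mono (g , mono-g , edges) h e∘h≡g =
  h , h-mono , λ i j edge → h-mono i j (proj₁ edge) ,
    subst₂ (λ u w → adj F u w ≡ true) (sym (e∘h≡g i)) (sym (e∘h≡g j)) (proj₂ (edges i j edge))
  where
  h-mono : StrictMono h
  h-mono i j i<j = strictMono-reflects mono _ _
    (subst₂ (λ u w → toℕ u < toℕ w) (sym (e∘h≡g i)) (sym (e∘h≡g j)) (mono-g i j i<j))

copy-map : (emb : SubgraphEmb M K) (c : Colouring K) {b : Bool} →
  CopyWith H M (λ u w → c (proj₁ emb u) (proj₁ emb w) ≡ b) → CopyWith H K (λ u w → c u w ≡ b)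
copy-map (g , mono-g , edges-g) c (f , mono-f , edges-f) =
  g ∘ f , (λ i j → mono-g _ _ ∘ mono-f i j) ,
  λ i j e → edges-g _ _ (proj₁ (edges-f i j e)) , proj₂ (edges-f i j e)

arrows-⊆ : SubgraphEmb M K → Arrows M X Y → Arrows K X Y
arrows-⊆ {K = K} emb arrows c =
  Sum.map (copy-map {K = K} emb c) (copy-map {K = K} emb c) (arrows (λ u w → c (proj₁ emb u) (proj₁ emb w)))

arrows⇒arrowsIn-image : (emb : SubgraphEmb M F) → Arrows M X Y →
  ArrowsIn F X Y (_∈ map (proj₁ emb) (allFin (size M)))
arrows⇒arrowsIn-image {M = M} {F = F} emb arrows c =
  pure (Sum.map toMonoCopy toMonoCopy (arrows (λ u w → c (proj₁ emb u) (proj₁ emb w))))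
  where
  toMonoCopy : ∀ {H b} → CopyWith H M (λ u w → c (proj₁ emb u) (proj₁ emb w) ≡ b) →
    MonoCopy H F c b (_∈ map (proj₁ emb) (allFin (size M)))
  toMonoCopy copy = let (f , mono , edges) = copy-map {K = F} emb c copy in
    monoCopy f mono edges λ i → ∈-map⁺ (proj₁ emb) (∈-allFin (proj₁ copy i))

-- Colour the edges of F through the preimage of e; deciding whether a monochromatic copy
-- inside P exists turns the classical ArrowsIn into a copy in the induced subgraph.
module _ {F : OrdGraph} {P : VertexSet F} (P? : Decidable P)
         {e : Fin m → Fin (size F)} (mono : StrictMono e) (preimage : ∀ {u} → P u → ∃ λ i → e i ≡ u) where

  arrowsIn⇒arrows-induce : ArrowsIn F X Y P → Arrows (induce F e) X Y
  arrowsIn⇒arrows-induce arrows c′ =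
    Sum.map pull pull (decidable-stable (monoCopy? c true P? ⊎-dec monoCopy? c false P?) (arrows c))
    where
    back : ∀ {u} → P u → Fin m
    back = proj₁ ∘ preimage

    back-unique : ∀ {u} (pu pu′ : P u) → back pu ≡ back pu′
    back-unique pu pu′ = strictMono⇒injective mono (trans (proj₂ (preimage pu)) (sym (proj₂ (preimage pu′))))

    c : Colouring F
    c u w with P? u | P? w
    ... | yes pu | yes pw = c′ (back pu) (back pw)
    ... | _      | _      = true

    c-agrees : ∀ {u w} (pu : P u) (pw : P w) → c u w ≡ c′ (back pu) (back pw)
    c-agrees {u} {w} pu pw with P? u | P? w
    ... | yes pu′ | yes pw′ = cong₂ c′ (back-unique pu′ pu) (back-unique pw′ pw)
    ... | no ¬pu  | _       = ⊥-elim (¬pu pu)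
    ... | yes _   | no ¬pw  = ⊥-elim (¬pw pw)

    pull : ∀ {H b} → MonoCopy H F c b P → CopyWith H (induce F e) (λ i j → c′ i j ≡ b)
    pull {H} (monoCopy f mono-f edges inside) =
      proj₁ emb , proj₁ (proj₂ emb) , λ i j edge → proj₂ (proj₂ emb) i j edge ,
        trans (sym (c-agrees (inside i) (inside j))) (proj₂ (edges i j edge))
      where
      emb : SubgraphEmb H (induce F e)
      emb = subgraphEmb-induce {F = F} mono (f , mono-f , λ i j → proj₁ ∘ edges i j) (λ i → back (inside i))
                               (λ i → proj₂ (preimage (inside i)))

deleteVertex : (F : OrdGraph) → Fin (size F) → OrdGraph
deleteVertex (mkOG (suc m) a) v = induce (mkOG (suc m) a) (punchIn v)

deleteVertex-proper : (v : Fin (size F)) → ProperSubgraph (deleteVertex F v) F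
deleteVertex-proper {F = mkOG (suc m) a} v =
  induce-emb {F = mkOG (suc m) a} (punchIn-strictMono v) , inj₁ (v , Fin.punchInᵢ≢i v)

subgraphEmb-deleteVertex : {v : Fin (size F)} (emb : SubgraphEmb H F) → (∀ i → proj₁ emb i ≢ v) →
  SubgraphEmb H (deleteVertex F v)
subgraphEmb-deleteVertex {F = mkOG (suc m) a} {v = v} emb misses =
  subgraphEmb-induce {F = mkOG (suc m) a} (punchIn-strictMono v) emb
    (λ i → punchOut (misses i ∘ sym)) (λ i → Fin.punchIn-punchOut _)

arrowsIn⇒arrows-deleteVertex : {P : VertexSet F} → Decidable P → {v : Fin (size F)} → ¬ P v →
  ArrowsIn F X Y P → Arrows (deleteVertex F v) X Y
arrowsIn⇒arrows-deleteVertex {F = mkOG (suc m) a} P? {v} ¬Pv =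
  arrowsIn⇒arrows-induce P? (punchIn-strictMono v) λ {u} Pu → punchOut (v≢ Pu) , Fin.punchIn-punchOut (v≢ Pu)
  where
  v≢ : ∀ {u} → _ → v ≢ u
  v≢ Pu refl = ¬Pv Pu

removeEdge : (F : OrdGraph) → Fin (size F) → Fin (size F) → OrdGraph
removeEdge F x y = mkOG (size F) λ u w → if does (u Fin.≟ x) ∧ does (w Fin.≟ y) then false else adj F u w

removeEdge-emb : {x y : Fin (size F)} → SubgraphEmb (removeEdge F x y) F
removeEdge-emb {F = F} {x} {y} = id , (λ _ _ i<j → i<j) , λ u w (u<w , a) → u<w , kept u w a
  where
  kept : ∀ u w → (if does (u Fin.≟ x) ∧ does (w Fin.≟ y) then false else adj F u w) ≡ true →
    adj F u w ≡ true
  kept u w with does (u Fin.≟ x) ∧ does (w Fin.≟ y)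
  ... | true = λ ()
  ... | false = id

removeEdge-removes : (x y : Fin (size F)) → ¬ Edge (removeEdge F x y) x y
removeEdge-removes x y (_ , a)
  rewrite dec-true (x Fin.≟ x) refl | dec-true (y Fin.≟ y) refl = case a of λ ()

subgraphEmb-removeEdge : (emb : SubgraphEmb H F) → ∀ {i j} → ¬ Edge H i j →
  SubgraphEmb H (removeEdge F (proj₁ emb i) (proj₁ emb j))
subgraphEmb-removeEdge {H = H} {F = F} (g , mono , edges) {i} {j} ¬edge = g , mono , kept
  where
  kept : ∀ i′ j′ → Edge H i′ j′ → Edge (removeEdge F (g i) (g j)) (g i′) (g j′)
  kept i′ j′ edge with g i′ Fin.≟ g i | g j′ Fin.≟ g j
  ... | yes gi′≡gi | yes gj′≡gj
    rewrite strictMono⇒injective mono gi′≡gi | strictMono⇒injective mono gj′≡gj = ⊥-elim (¬edge edge)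
  ... | yes _ | no _ = edges i′ j′ edge
  ... | no _  | _    = edges i′ j′ edge

sumFin : (Fin n → ℕ) → ℕ
sumFin {zero} f = 0
sumFin {suc n} f = f zero + sumFin (f ∘ suc)

sumFin-mono : {f g : Fin n → ℕ} → (∀ i → f i ≤ g i) → sumFin f ≤ sumFin g
sumFin-mono {zero} f≤g = z≤n
sumFin-mono {suc n} f≤g = ℕ.+-mono-≤ (f≤g zero) (sumFin-mono (f≤g ∘ suc))

sumFin-mono-< : {f g : Fin n → ℕ} → (∀ i → f i ≤ g i) → ∀ k → f k < g k → sumFin f < sumFin g
sumFin-mono-< f≤g zero fk<gk = ℕ.+-mono-<-≤ fk<gk (sumFin-mono (f≤g ∘ suc))
sumFin-mono-< f≤g (suc k) fk<gk = ℕ.+-mono-≤-< (f≤g zero) (sumFin-mono-< (f≤g ∘ suc) k fk<gk)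

indicator : Dec A → ℕ
indicator a? = if does a? then 1 else 0

indicator-mono : (A → B) → (a? : Dec A) (b? : Dec B) → indicator a? ≤ indicator b?
indicator-mono A→B (yes a) (yes _) = ℕ.≤-refl
indicator-mono A→B (yes a) (no ¬b) = ⊥-elim (¬b (A→B a))
indicator-mono A→B (no _) b? = z≤n

indicator-< : ¬ A → B → (a? : Dec A) (b? : Dec B) → indicator a? < indicator b?
indicator-< ¬a b (yes a) _ = ⊥-elim (¬a a)
indicator-< ¬a b (no _) (yes _) = ℕ.≤-refl
indicator-< ¬a b (no _) (no ¬b) = ⊥-elim (¬b b)

edgeCount : OrdGraph → ℕ
edgeCount F = sumFin λ i → sumFin λ j → indicator (Edge? F i j)

edgeCount-removeEdge : {x y : Fin (size F)} → Edge F x y → edgeCount (removeEdge F x y) < edgeCount F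
edgeCount-removeEdge {F = F} {x} {y} edge =
  sumFin-mono-< (λ i → sumFin-mono (fewer i)) x (sumFin-mono-< (fewer x) y removed)
  where
  F∖xy = removeEdge F x y
  fewer : ∀ i j → indicator (Edge? F∖xy i j) ≤ indicator (Edge? F i j)
  fewer i j = indicator-mono (proj₂ (proj₂ (removeEdge-emb {F = F} {x} {y})) i j) (Edge? F∖xy i j) (Edge? F i j)
  removed : indicator (Edge? F∖xy x y) < indicator (Edge? F x y)
  removed = indicator-< (removeEdge-removes {F = F} x y) edge (Edge? F∖xy x y) (Edge? F x y)

module _ (X Y : OrdGraph) where

  MinimalSubgraph : OrdGraph → Set
  MinimalSubgraph F = Σ OrdGraph λ M → SubgraphEmb M F × Minimal M X Y

  minimalSubgraph-⊆ : SubgraphEmb K F → MinimalSubgraph K → MinimalSubgraph F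
  minimalSubgraph-⊆ {K = K} {F = F} K⊆F (M , M⊆K , minimal) =
    M , subgraphEmb-∘ {K = K} {F = F} M⊆K K⊆F , minimal

  private
    Descends : OrdGraph → Set
    Descends F = Arrows F X Y → ¬ ¬ MinimalSubgraph F

    descend-step : (∀ {x y} → Edge F x y → Descends (removeEdge F x y)) →
      (∀ v → Descends (deleteVertex F v)) → Descends F
    descend-step {F = F} edge-case vertex-case arrows = do
      yes (G , (G⊆F@(_ , _ , _) , missing) , arrowsG) ←
          ¬¬-excluded-middle {A = Σ OrdGraph λ G → ProperSubgraph G F × Arrows G X Y}
        where no none → pure (F , subgraphEmb-refl {F = F} , arrows ,
                               λ G proper arrowsG → none (G , proper , arrowsG))
      [ (λ (v , misses) → via-vertex v (subgraphEmb-deleteVertex {F = F} G⊆F misses) arrowsG)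
        , (λ (_ , _ , edge , ¬edge) → via-edge edge (subgraphEmb-removeEdge {F = F} G⊆F ¬edge) arrowsG)
        ]′ missing
      where
      via-vertex : ∀ {G} v → SubgraphEmb G (deleteVertex F v) → Arrows G X Y → ¬ ¬ MinimalSubgraph F
      via-vertex v G⊆ arrowsG = minimalSubgraph-⊆ {F = F} (proj₁ (deleteVertex-proper {F = F} v))
                                  <$> vertex-case v (arrows-⊆ {K = deleteVertex F v} G⊆ arrowsG)
      via-edge : ∀ {G x y} → Edge F x y → SubgraphEmb G (removeEdge F x y) → Arrows G X Y →
        ¬ ¬ MinimalSubgraph F
      via-edge {x = x} {y} edge G⊆ arrowsG = minimalSubgraph-⊆ {F = F} (removeEdge-emb {F = F})
                                               <$> edge-case edge (arrows-⊆ {K = removeEdge F x y} G⊆ arrowsG)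

    -- Lexicographic descent: deleting a vertex lowers the size, deleting an edge keeps
    -- the size and lowers the edge count.
    descend : ∀ n (a : Fin n → Fin n → Bool) k → edgeCount (mkOG n a) < k → Descends (mkOG n a)
    descend n a (suc k) count<k = descend-step {F = mkOG n a} edge-case (vertex-case n a)
      where
      edge-case : ∀ {x y} → Edge (mkOG n a) x y → Descends (removeEdge (mkOG n a) x y)
      edge-case {x} {y} edge = descend n (adj (removeEdge (mkOG n a) x y)) k
        (ℕ.<-≤-trans (edgeCount-removeEdge {F = mkOG n a} edge) (ℕ.≤-pred count<k))
      vertex-case : ∀ n (a : Fin n → Fin n → Bool) v → Descends (deleteVertex (mkOG n a) v)
      vertex-case (suc m) a v = descend m (adj (deleteVertex (mkOG (suc m) a) v))
                                         (suc (edgeCount (deleteVertex (mkOG (suc m) a) v))) ℕ.≤-refl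

  minimalSubgraph : Arrows F X Y → ¬ ¬ MinimalSubgraph F
  minimalSubgraph {F = F} = descend (size F) (adj F) (suc (edgeCount F)) ℕ.≤-refl

-- Ramsey-finite pairs have small cores

module Interval {F : OrdGraph} {q₀ q : ℕ} (q₀≤q : q₀ ≤ q) (q≤n : q ≤ size F) where

  private
    shift< : ∀ {k} → k < q ∸ q₀ → q₀ + k < size F
    shift< k< = ℕ.<-≤-trans (ℕ.+-monoʳ-< q₀ k<) (ℕ.≤-trans (ℕ.≤-reflexive (ℕ.m+[n∸m]≡n q₀≤q)) q≤n)

  shift : Fin (q ∸ q₀) → Fin (size F)
  shift i = fromℕ< (shift< (Fin.toℕ<n i))

  toℕ-shift : ∀ i → toℕ (shift i) ≡ q₀ + toℕ i
  toℕ-shift i = Fin.toℕ-fromℕ< _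

  shift-strictMono : StrictMono shift
  shift-strictMono i j i<j = subst₂ _<_ (sym (toℕ-shift i)) (sym (toℕ-shift j)) (ℕ.+-monoʳ-< q₀ i<j)

  shift-Between : ∀ i → Between q₀ q (shift i)
  shift-Between i rewrite toℕ-shift i =
    ℕ.m≤m+n q₀ (toℕ i) , ℕ.<-≤-trans (ℕ.+-monoʳ-< q₀ (Fin.toℕ<n i)) (ℕ.≤-reflexive (ℕ.m+[n∸m]≡n q₀≤q))

  shift-preimage : ∀ {u} → Between q₀ q u → ∃ λ i → shift i ≡ u
  shift-preimage {u} (q₀≤u , u<q) = fromℕ< u-q₀< , Fin.toℕ-injective (begin
      toℕ (shift (fromℕ< u-q₀<))  ≡⟨ toℕ-shift _ ⟩
      q₀ + toℕ (fromℕ< u-q₀<)     ≡⟨ cong (q₀ +_) (Fin.toℕ-fromℕ< u-q₀<) ⟩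
      q₀ + (toℕ u ∸ q₀)           ≡⟨ ℕ.m+[n∸m]≡n q₀≤u ⟩
      toℕ u                       ∎)
    where
    open ≡-Reasoning
    u-q₀< : toℕ u ∸ q₀ < q ∸ q₀
    u-q₀< = ℕ.∸-monoˡ-< u<q q₀≤u

maxSize : List OrdGraph → ℕ
maxSize [] = 0
maxSize (G ∷ L) = size G ℕ.⊔ maxSize L

maxSize-∈ : {L : List OrdGraph} → F ∈ L → size F ≤ maxSize L
maxSize-∈ {L = G ∷ L} (here refl) = ℕ.m≤m⊔n (size G) (maxSize L)
maxSize-∈ {L = G ∷ L} (there F∈L) = ℕ.≤-trans (maxSize-∈ F∈L) (ℕ.m≤n⊔m (size G) (maxSize L))

-- A minimal arrowing subgraph of the interval is isomorphic to a listed minimal graph.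
ramseyFinite⇒smallCores : LooselyConnected X → LooselyConnected Y → (finite : RamseyFinite X Y) →
  SmallCores X Y (maxSize (proj₁ finite))
ramseyFinite⇒smallCores {X = X} {Y = Y} connected connected′ (L , covered) F {q₀} {q} q≤n arrows = do
  (M , M⊆I , minimal) ← minimalSubgraph X Y {F = I}
    (arrowsIn⇒arrows-induce {F = F} (Between? q₀ q) shift-strictMono shift-preimage arrows)
  let (G , G∈L , (iso , iso-mono , _)) = covered M minimal
      M⊆F = subgraphEmb-∘ {K = I} {F = F} M⊆I (induce-emb {F = F} shift-strictMono)
  pure ( map (proj₁ M⊆F) (allFin (size M))
       , subst (_≤ maxSize L) (sym (trans (length-map _ (allFin (size M))) (length-tabulate id)))
               (ℕ.≤-trans (Fin.injective⇒≤ (strictMono⇒injective iso-mono)) (maxSize-∈ G∈L))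
       , (λ {u} u∈ → let (i , _ , u≡) = ∈-map⁻ (proj₁ M⊆F) u∈ in
                     subst (Between q₀ q) (sym u≡) (shift-Between (proj₁ M⊆I i)))
       , arrows⇒arrowsIn-image M⊆F (proj₁ minimal))
  where
  q₀≤q : q₀ ≤ q
  q₀≤q = ℕ.<⇒≤ (arrowsIn-interval (firstVertex connected) (firstVertex connected′) arrows)
  open Interval {F = F} q₀≤q q≤n
  I : OrdGraph
  I = induce F shift

-- Bounding the minimal graphs

_∈?_ : (u : Fin n) (S : List (Fin n)) → Dec (u ∈ S)
_∈?_ = DecMembership._∈?_ Fin._≟_

missing-vertex : (S : List (Fin n)) → length S < n → ∃ λ v → ¬ v ∈ S
missing-vertex {n} S |S|<n with Fin.all? (_∈? S)
... | no ¬all = Fin.¬∀⟶∃¬ n _ (_∈? S) ¬all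
... | yes all = ⊥-elim (ℕ.<⇒≱ |S|<n (Fin.injective⇒≤ index-injective))
  where
  index-injective : Injective _≡_ _≡_ (λ v → Any.index (all v))
  index-injective {u} {v} same = trans (Anyₚ.lookup-index (all u))
                                   (trans (cong (lookup S) same) (sym (Anyₚ.lookup-index (all v))))

graphsOfSize : ℕ → List OrdGraph
graphsOfSize n = map (mkOG n) (functions n (functions n (true ∷ false ∷ [])))

graphsUpTo : ℕ → List OrdGraph
graphsUpTo zero = graphsOfSize 0
graphsUpTo (suc N) = graphsOfSize (suc N) ++ graphsUpTo N

graphsOfSize-complete : (F : OrdGraph) → Any (OrdIso F) (graphsOfSize (size F))
graphsOfSize-complete F = Anyₚ.map⁺ (Any.map iso (functions-complete _ (functions-complete _≡_ bool) (adj F)))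
  where
  bool : ∀ x → Any (x ≡_) (true ∷ false ∷ [])
  bool true = here refl
  bool false = there (here refl)
  iso : ∀ {a} → (∀ i j → adj F i j ≡ a i j) → OrdIso F (mkOG (size F) a)
  iso same = id , (λ _ _ i<j → i<j) , (λ v → v , refl) ,
    λ i j → (λ (i<j , e) → i<j , trans (sym (same i j)) e) , (λ (i<j , e) → i<j , trans (same i j) e)

graphsUpTo-complete : ∀ N (F : OrdGraph) → size F ≤ N → Any (OrdIso F) (graphsUpTo N)
graphsUpTo-complete zero F size≤0 =
  subst (Any (OrdIso F) ∘ graphsOfSize) (ℕ.n≤0⇒n≡0 size≤0) (graphsOfSize-complete F)
graphsUpTo-complete (suc N) F size≤ with ℕ.m≤n⇒m<n∨m≡n size≤
... | inj₁ size< = Anyₚ.++⁺ʳ (graphsOfSize (suc N)) (graphsUpTo-complete N F (ℕ.≤-pred size<))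
... | inj₂ refl  = Anyₚ.++⁺ˡ (graphsOfSize-complete F)

module _ {s t : ℕ} {H : Fin (suc s) → OrdGraph} {H′ : Fin (suc t) → OrdGraph}
         (connected : ∀ i → LooselyConnected (H i)) (connected′ : ∀ j → LooselyConnected (H′ j))
         (finite : ∀ i j → RamseyFinite (H i) (H′ j)) where

  sizeBound : ℕ
  sizeBound = sequenceBound (λ i j → maxSize (proj₁ (finite i j))) (allFin (suc s)) (allFin (suc t))

  -- A minimal F has an arrowing set of at most sizeBound vertices; a vertex outside it
  -- could be deleted without destroying the arrowing, contradicting minimality.
  minimal-size≤ : Minimal F (⨆ (suc s) H) (⨆ (suc t) H′) → size F ≤ sizeBound
  minimal-size≤ {F} (arrows , minimal) = decidable-stable (size F ≤? sizeBound) do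
    (S , |S|≤ , _ , arrowsS) ← sequences-smallWitnesses connected connected′
      (λ i j → ramseyFinite⇒smallCores (connected i) (connected′ j) (finite i j)) F (allFin _) (allFin _) {0}
      λ c → pure (Sum.map (monoCopy-⨆⇒sequence H s id ∘ fromCopy) (monoCopy-⨆⇒sequence H′ t id ∘ fromCopy)
                          (arrows c))
    λ size≰ → let (v , v∉S) = missing-vertex S (ℕ.≤-<-trans |S|≤ (ℕ.≰⇒> size≰)) in
      minimal (deleteVertex F v) (deleteVertex-proper {F = F} v)
        (arrowsIn⇒arrows-deleteVertex {F = F} (_∈? S) v∉S λ c →
           Sum.map (sequence⇒monoCopy-⨆ H s id) (sequence⇒monoCopy-⨆ H′ t id) <$> arrowsS c)
    where
    fromCopy : ∀ {X c b} → CopyWith X F (λ u w → c u w ≡ b) → MonoCopy X F c b (From 0)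
    fromCopy (f , mono , edges) = monoCopy f mono edges λ _ → z≤n

theorem9 : (s t : ℕ) → 1 ≤ s → 1 ≤ t
    → (H : Fin s → OrdGraph) → (H' : Fin t → OrdGraph)
    → (∀ i → LooselyConnected (H i))
    → (∀ j → LooselyConnected (H' j))
    → (∀ i j → RamseyFinite (H i) (H' j))
    → RamseyFinite (⨆ s H) (⨆ t H')
theorem9 (suc s) (suc t) _ _ H H′ connected connected′ finite =
  graphsUpTo (sizeBound connected connected′ finite) ,
  λ F minimal → find (graphsUpTo-complete _ F (minimal-size≤ connected connected′ finite {F = F} minimal))
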